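{- Let $(L,\preceq)$ be a lattice and let $\delta$ be an equivalence relation on $L$. Then $\delta$ is a local congruence if and only if, for all $a,b,c\in L$: whenever $(a,b)\in\delta$ and $a\wedge b\preceq c\preceq a\vee b$, we have $(a\vee c,\,b\vee c)\in\delta$ and $(a\wedge c,\,b\wedge c)\in\delta$.
   Context: A local congruence on a lattice $(L,\preceq)$ (with meet $\wedge$ and join $\vee$) is an equivalence relation $\delta$ on $L$ such that (1) each equivalence class of $\delta$ is a sublattice of $L$ (closed under $\wedge$ and $\vee$), and (2) each equivalence class of $\delta$ is convex, i.e. if $x,y$ belong to a class and $x\preceq z\preceq y$, then $z$ belongs to that class. -}

module Defs where

open import Level using (Level; _⊔_)
open import Data.Product using (_×_)
open import Relation.Binary.Core using (Rel)
open import Relation.Binary.Structures using (IsEquivalence)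
open import Relation.Binary.Lattice.Bundles using (Lattice)

module _ {c ℓ₁ ℓ₂ ℓ : Level} (L : Lattice c ℓ₁ ℓ₂) where
  open Lattice L

  -- δ is an equivalence relation on the lattice (carrier taken up to the
  -- lattice's underlying equality ≈: δ contains ≈-related pairs).
  record IsLatticeEquivalence (δ : Rel Carrier ℓ) : Set (c ⊔ ℓ₁ ⊔ ℓ) where
    field
      isEquivalence : IsEquivalence δ
      respects-≈    : ∀ {x y} → x ≈ y → δ x y

  ClassesAreSublattices : Rel Carrier ℓ → Set (c ⊔ ℓ)
  ClassesAreSublattices δ =
    ∀ u x y → δ u x → δ u y → δ u (x ∧ y) × δ u (x ∨ y)

  ClassesAreConvex : Rel Carrier ℓ → Set (c ⊔ ℓ₂ ⊔ ℓ)
  ClassesAreConvex δ =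
    ∀ u x y z → δ u x → δ u y → x ≤ z → z ≤ y → δ u z

  IsLocalCongruence : Rel Carrier ℓ → Set (c ⊔ ℓ₁ ⊔ ℓ₂ ⊔ ℓ)
  IsLocalCongruence δ =
    IsLatticeEquivalence δ × ClassesAreSublattices δ × ClassesAreConvex δ

{-# OPTIONS --safe #-}

-- If a and b lie in one class, so do a ∧ b and a ∨ b, hence by convexity the whole
-- interval [a ∧ b, a ∨ b]; this interval contains c and is a sublattice, so a ∨ c,
-- b ∨ c, a ∧ c, b ∧ c all lie in the class of a. Conversely, choosing c = a turns
-- (a, b) ∈ δ into (a, a ∨ b), (a, a ∧ b) ∈ δ, and for a ≤ c ≤ b choosing c turns it
-- into (c, b) ∈ δ.
module Submission where

open import Defs
open import Level using (Level; _⊔_)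
open import Data.Product using (_×_; _,_; proj₁; proj₂)
open import Function.Bundles using (_⇔_; mk⇔)
open import Relation.Binary.Core using (Rel)
open import Relation.Binary.Structures using (IsEquivalence)
open import Relation.Binary.Lattice.Bundles using (Lattice)
import Relation.Binary.Lattice.Properties.JoinSemilattice as JoinProperties
import Relation.Binary.Lattice.Properties.MeetSemilattice as MeetProperties

module Intervals {c ℓ₁ ℓ₂ : Level} (L : Lattice c ℓ₁ ℓ₂) where
  open Lattice L

  _∈[_,_] : Carrier → Carrier → Carrier → Set ℓ₂
  z ∈[ p , q ] = p ≤ z × z ≤ q

  ∨-closed-interval : ∀ {p q x y} → x ∈[ p , q ] → y ∈[ p , q ] → (x ∨ y) ∈[ p , q ]
  ∨-closed-interval {x = x} {y} (p≤x , x≤q) (_ , y≤q) = trans p≤x (x≤x∨y x y) , ∨-least x≤q y≤q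

  ∧-closed-interval : ∀ {p q x y} → x ∈[ p , q ] → y ∈[ p , q ] → (x ∧ y) ∈[ p , q ]
  ∧-closed-interval {x = x} {y} (p≤x , x≤q) (p≤y , _) = ∧-greatest p≤x p≤y , trans (x∧y≤x x y) x≤q

  left∈[∧,∨] : ∀ x y → x ∈[ x ∧ y , x ∨ y ]
  left∈[∧,∨] x y = x∧y≤x x y , x≤x∨y x y

  right∈[∧,∨] : ∀ x y → y ∈[ x ∧ y , x ∨ y ]
  right∈[∧,∨] x y = x∧y≤y x y , y≤x∨y x y

module _ {c ℓ₁ ℓ₂ ℓ : Level} (L : Lattice c ℓ₁ ℓ₂) where
  open Lattice L
  open Intervals L

  IntervalCompatible : Rel Carrier ℓ → Set (c ⊔ ℓ₂ ⊔ ℓ)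
  IntervalCompatible δ =
    ∀ a b x → δ a b → a ∧ b ≤ x → x ≤ a ∨ b → δ (a ∨ x) (b ∨ x) × δ (a ∧ x) (b ∧ x)

  module _ {δ : Rel Carrier ℓ} (E : IsLatticeEquivalence L δ) where
    open IsLatticeEquivalence E using (respects-≈)
    open IsEquivalence (IsLatticeEquivalence.isEquivalence E)
      using () renaming (refl to δ-refl; sym to δ-sym; trans to δ-trans)
    open JoinProperties joinSemilattice using (∨-comm; ∨-idempotent; x≤y⇒x∨y≈y)
    open MeetProperties meetSemilattice using (∧-comm; ∧-idempotent)

    δ-resp-≈ : ∀ {x x′ y y′} → x ≈ x′ → y ≈ y′ → δ x y → δ x′ y′
    δ-resp-≈ x≈x′ y≈y′ xy = δ-trans (respects-≈ (Eq.sym x≈x′)) (δ-trans xy (respects-≈ y≈y′))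

    [∧,∨]⊆class : ClassesAreSublattices L δ → ClassesAreConvex L δ →
                  ∀ {a b z} → δ a b → z ∈[ a ∧ b , a ∨ b ] → δ a z
    [∧,∨]⊆class sublattice convex {a} {b} ab (lower , upper) =
      convex a (a ∧ b) (a ∨ b) _ a∧b a∨b lower upper
      where
      a∧b : δ a (a ∧ b)
      a∧b = proj₁ (sublattice a a b δ-refl ab)
      a∨b : δ a (a ∨ b)
      a∨b = proj₂ (sublattice a a b δ-refl ab)

    localCongruence⇒intervalCompatible : IsLocalCongruence L δ → IntervalCompatible δ
    localCongruence⇒intervalCompatible (_ , sublattice , convex) a b x ab lower upper =
      related (∨-closed-interval a∈I x∈I) (∨-closed-interval b∈I x∈I) ,
      related (∧-closed-interval a∈I x∈I) (∧-closed-interval b∈I x∈I)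
      where
      a∈I : a ∈[ a ∧ b , a ∨ b ]
      a∈I = left∈[∧,∨] a b
      b∈I : b ∈[ a ∧ b , a ∨ b ]
      b∈I = right∈[∧,∨] a b
      x∈I : x ∈[ a ∧ b , a ∨ b ]
      x∈I = lower , upper
      related : ∀ {u v} → u ∈[ a ∧ b , a ∨ b ] → v ∈[ a ∧ b , a ∨ b ] → δ u v
      related u∈I v∈I = δ-trans (δ-sym (class u∈I)) (class v∈I)
        where
        class : ∀ {z} → z ∈[ a ∧ b , a ∨ b ] → δ a z
        class = [∧,∨]⊆class sublattice convex ab

    module _ (compatible : IntervalCompatible δ) where
      related-∨ : ∀ {x y} → δ x y → δ x (x ∨ y)
      related-∨ {x} {y} xy =
        δ-resp-≈ (∨-idempotent x) (∨-comm y x)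
          (proj₁ (compatible x y x xy (x∧y≤x x y) (x≤x∨y x y)))

      related-∧ : ∀ {x y} → δ x y → δ x (x ∧ y)
      related-∧ {x} {y} xy =
        δ-resp-≈ (∧-idempotent x) (∧-comm y x)
          (proj₂ (compatible x y x xy (x∧y≤x x y) (x≤x∨y x y)))

      related-between : ∀ {x y z} → δ x y → x ≤ z → z ≤ y → δ z y
      related-between {x} {y} {z} xy x≤z z≤y =
        δ-resp-≈ (x≤y⇒x∨y≈y x≤z) (Eq.trans (∨-comm y z) (x≤y⇒x∨y≈y z≤y))
          (proj₁ (compatible x y z xy (trans (x∧y≤x x y) x≤z) (trans z≤y (y≤x∨y x y))))

      intervalCompatible⇒localCongruence : IsLocalCongruence L δ
      intervalCompatible⇒localCongruence = E , sublattice , convex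
        where
        sublattice : ClassesAreSublattices L δ
        sublattice u x y ux uy =
          δ-trans ux (related-∧ (δ-trans (δ-sym ux) uy)) ,
          δ-trans ux (related-∨ (δ-trans (δ-sym ux) uy))
        convex : ClassesAreConvex L δ
        convex u x y z ux uy x≤z z≤y =
          δ-trans uy (δ-sym (related-between (δ-trans (δ-sym ux) uy) x≤z z≤y))

proposition16 : {c ℓ₁ ℓ₂ ℓ : Level} (L : Lattice c ℓ₁ ℓ₂) (δ : Rel (Lattice.Carrier L) ℓ) →
    IsLatticeEquivalence L δ →
    IsLocalCongruence L δ ⇔
      (∀ a b x → δ a b → Lattice._≤_ L (Lattice._∧_ L a b) x → Lattice._≤_ L x (Lattice._∨_ L a b) →
        δ (Lattice._∨_ L a x) (Lattice._∨_ L b x) × δ (Lattice._∧_ L a x) (Lattice._∧_ L b x))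
proposition16 L δ E =
  mk⇔ (localCongruence⇒intervalCompatible L E) (intervalCompatible⇒localCongruence L E)
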